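{- Let $F$ be a formally real, non-pythagorean field admitting a supreme torsion form $\varphi$. Then $u(F)$ is finite and $u(F)=\dim\varphi$.
   Context: Quadratic forms are nondegenerate and finite-dimensional. A form is torsion if its Witt class is torsion in $WF$. A supreme torsion form over $F$ is an anisotropic torsion form such that every anisotropic torsion form over $F$ is similar to a subform of it. $u(F)$ is the supremum of the dimensions of anisotropic torsion forms over $F$. -}

module Defs where

open import Level using (Level; _⊔_; suc)
open import Algebra.Bundles using (CommutativeRing)
open import Data.Nat using (ℕ; zero; _≤_; _≥_) renaming (suc to sucℕ; _+_ to _+ℕ_)
open import Data.Fin using (Fin; splitAt)
open import Data.Sum using (_⊎_; inj₁; inj₂)
open import Data.Product using (Σ; ∃; _×_; _,_)
open import Data.List using (List; []; _∷_)
open import Relation.Nullary using (¬_)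

record Field (c ℓ : Level) : Set (Level.suc (c ⊔ ℓ)) where
  field
    commutativeRing : CommutativeRing c ℓ
  open CommutativeRing commutativeRing public
  field
    0≉1     : ¬ (0# ≈ 1#)
    inverse : ∀ x → ¬ (x ≈ 0#) → Σ Carrier λ y → x * y ≈ 1#

module FieldTheory {c ℓ : Level} (F : Field c ℓ) where
  open Field F

  sumSq : List Carrier → Carrier
  sumSq []       = 0#
  sumSq (x ∷ xs) = x * x + sumSq xs

  FormallyReal : Set (c ⊔ ℓ)
  FormallyReal = ∀ (xs : List Carrier) → ¬ (sumSq xs ≈ - 1#)

  Pythagorean : Set (c ⊔ ℓ)
  Pythagorean = ∀ (xs : List Carrier) → Σ Carrier λ y → y * y ≈ sumSq xs

  NonPythagorean : Set (c ⊔ ℓ)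
  NonPythagorean = ¬ Pythagorean

  Vec : ℕ → Set c
  Vec n = Fin n → Carrier

  Σ[_] : ∀ {n} → (Fin n → Carrier) → Carrier
  Σ[_] {zero}   f = 0#
  Σ[_] {sucℕ n} f = f Fin.zero + Σ[_] (λ i → f (Fin.suc i))

  Mat : ℕ → ℕ → Set c
  Mat m n = Fin m → Fin n → Carrier

  apply : ∀ {m n} → Mat m n → Vec n → Vec m
  apply M v i = Σ[ (λ j → M i j * v j) ]

  record Form : Set c where
    constructor form
    field
      dim  : ℕ
      gram : Mat dim dim
  open Form public

  bil : (φ : Form) → Vec (dim φ) → Vec (dim φ) → Carrier
  bil φ v w = Σ[ (λ i → Σ[ (λ j → v i * gram φ i j * w j) ]) ]

  qf : (φ : Form) → Vec (dim φ) → Carrier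
  qf φ v = bil φ v v

  IsZeroVec : ∀ {n} → Vec n → Set ℓ
  IsZeroVec v = ∀ i → v i ≈ 0#

  IsForm : Form → Set (c ⊔ ℓ)
  IsForm φ = (∀ i j → gram φ i j ≈ gram φ j i)
           × (∀ v → (∀ w → bil φ v w ≈ 0#) → IsZeroVec v)

  Anisotropic : Form → Set (c ⊔ ℓ)
  Anisotropic φ = ∀ v → qf φ v ≈ 0# → IsZeroVec v

  Isometric : Form → Form → Set (c ⊔ ℓ)
  Isometric φ ψ =
    Σ (Mat (dim ψ) (dim φ)) λ M → Σ (Mat (dim φ) (dim ψ)) λ N →
      (∀ v i → apply N (apply M v) i ≈ v i)
    × (∀ w i → apply M (apply N w) i ≈ w i)
    × (∀ v w → bil ψ (apply M v) (apply M w) ≈ bil φ v w)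

  _⊥_ : Form → Form → Form
  φ ⊥ ψ = form (dim φ +ℕ dim ψ) G
    where
    G : Mat (dim φ +ℕ dim ψ) (dim φ +ℕ dim ψ)
    G i j with splitAt (dim φ) i | splitAt (dim φ) j
    ... | inj₁ a | inj₁ b = gram φ a b
    ... | inj₂ a | inj₂ b = gram ψ a b
    ... | inj₁ _ | inj₂ _ = 0#
    ... | inj₂ _ | inj₁ _ = 0#

  𝟘 : Form
  𝟘 = form 0 (λ ())

  _×ᶠ_ : ℕ → Form → Form
  zero   ×ᶠ φ = 𝟘
  sucℕ k ×ᶠ φ = φ ⊥ (k ×ᶠ φ)

  -- hyperbolic plane ⟨1,-1⟩ ≅ [[0,1],[1,0]]
  ℍ : Form
  ℍ = form 2 H
    where
    H : Mat 2 2
    H Fin.zero Fin.zero = 0#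
    H Fin.zero (Fin.suc _) = 1#
    H (Fin.suc _) Fin.zero = 1#
    H (Fin.suc _) (Fin.suc _) = 0#

  -- hyperbolic: isometric to r × ℍ for some r (i.e. Witt class 0)
  Hyperbolic : Form → Set (c ⊔ ℓ)
  Hyperbolic φ = Σ ℕ λ r → Isometric φ (r ×ᶠ ℍ)

  -- torsion: the Witt class is torsion in WF, i.e. k[φ] = 0 for some k ≥ 1,
  -- i.e. k × φ is hyperbolic
  Torsion : Form → Set (c ⊔ ℓ)
  Torsion φ = Σ ℕ λ k → (k ≥ 1) × Hyperbolic (k ×ᶠ φ)

  _·ᶠ_ : Carrier → Form → Form
  a ·ᶠ φ = form (dim φ) (λ i j → a * gram φ i j)

  SimilarToSubform : Form → Form → Set (c ⊔ ℓ)
  SimilarToSubform ψ φ =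
    Σ Carrier λ a → ¬ (a ≈ 0#) × Σ Form λ χ → IsForm χ × Isometric φ ((a ·ᶠ ψ) ⊥ χ)

  AnisoTorsion : Form → Set (c ⊔ ℓ)
  AnisoTorsion φ = IsForm φ × Anisotropic φ × Torsion φ

  Supreme : Form → Set (c ⊔ ℓ)
  Supreme φ = AnisoTorsion φ × (∀ ψ → AnisoTorsion ψ → SimilarToSubform ψ φ)

  -- u(F) is finite and equals n: n is the supremum (= maximum, since ℕ-valued)
  -- of the dimensions of anisotropic torsion forms.
  UInvariantIs : ℕ → Set (c ⊔ ℓ)
  UInvariantIs n = (∀ ψ → AnisoTorsion ψ → dim ψ ≤ n)
                 × (∀ m → (∀ ψ → AnisoTorsion ψ → dim ψ ≤ m) → n ≤ m)

{-# OPTIONS --safe #-}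
-- Supremacy bounds every anisotropic torsion form ψ by dim φ: φ ≅ aψ ⊥ χ, and isometric forms
-- have the same dimension, since a linear map F^m → F^n with a left inverse forces m ≤ n
-- (a matrix with fewer rows than columns has a nonzero kernel vector, by Gaussian elimination).
-- Conversely φ is itself an anisotropic torsion form, so dim φ is attained.
module Submission where

open import Defs
open import Level using (Level; _⊔_)
open import Data.Nat using (zero; suc; _≤_; _<_; _≤?_; s≤s)
open import Data.Nat.Properties using (≰⇒>; ≤-antisym; ≤-trans; ≤-reflexive; m≤m+n)
open import Data.Fin using (Fin; punchIn; punchOut)
open import Data.Fin.Properties using (punchIn-punchOut) renaming (_≟_ to _≟ᶠ_)
open import Data.Empty using (⊥-elim)
open import Data.Product using (∃; _,_; proj₁; proj₂)
open import Function using (_∘_)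
open import Relation.Nullary using (¬_; yes; no)
open import Relation.Nullary.Decidable using (¬¬-excluded-middle)
open import Relation.Nullary.Negation using (¬∃⟶∀¬)
open import Relation.Binary.PropositionalEquality as ≡ using (_≡_)
import Algebra.Properties.Ring as RingProperties
import Algebra.Properties.CommutativeSemigroup as CommutativeSemigroupProperties
import Relation.Binary.Reasoning.Setoid as SetoidReasoning

¬¬-Π-Fin : ∀ {p n} {P : Fin n → Set p} → (∀ i → ¬ ¬ P i) → ¬ ¬ (∀ i → P i)
¬¬-Π-Fin {n = zero}  _ k = k λ ()
¬¬-Π-Fin {n = suc n} h k = h Fin.zero λ p₀ → ¬¬-Π-Fin (h ∘ Fin.suc) λ ps →
  k λ { Fin.zero → p₀ ; (Fin.suc i) → ps i }

module LinearAlgebra {c ℓ : Level} (F : Field c ℓ) where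
  open Field F
  open FieldTheory F
  open RingProperties ring using (-‿distribˡ-*; -‿distribʳ-*; -1*x≈-x)
  open CommutativeSemigroupProperties +-commutativeSemigroup using (interchange)
  open SetoidReasoning setoid

  Σ-cong : ∀ {n} {f g : Fin n → Carrier} → (∀ i → f i ≈ g i) → Σ[ f ] ≈ Σ[ g ]
  Σ-cong {zero}  _  = refl
  Σ-cong {suc n} eq = +-cong (eq Fin.zero) (Σ-cong (eq ∘ Fin.suc))

  Σ-zero : ∀ {n} {f : Fin n → Carrier} → (∀ i → f i ≈ 0#) → Σ[ f ] ≈ 0#
  Σ-zero {zero}  _  = refl
  Σ-zero {suc n} eq = trans (+-cong (eq Fin.zero) (Σ-zero (eq ∘ Fin.suc))) (+-identityˡ 0#)

  Σ-+ : ∀ {n} (f g : Fin n → Carrier) → Σ[ (λ i → f i + g i) ] ≈ Σ[ f ] + Σ[ g ]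
  Σ-+ {zero}  _ _ = sym (+-identityˡ 0#)
  Σ-+ {suc n} f g = trans (+-cong refl (Σ-+ (f ∘ Fin.suc) (g ∘ Fin.suc))) (interchange _ _ _ _)

  *-distribˡ-Σ : ∀ {n} a (f : Fin n → Carrier) → Σ[ (λ i → a * f i) ] ≈ a * Σ[ f ]
  *-distribˡ-Σ {zero}  a _ = sym (zeroʳ a)
  *-distribˡ-Σ {suc n} a f = trans (+-cong refl (*-distribˡ-Σ a (f ∘ Fin.suc))) (sym (distribˡ a _ _))

  apply-zero : ∀ {m n} (A : Mat m n) {v : Vec n} → IsZeroVec v → IsZeroVec (apply A v)
  apply-zero A v≈0 i = Σ-zero λ j → trans (*-cong refl (v≈0 j)) (zeroʳ _)

  Kernel : ∀ {m n} → Mat m n → Vec n → Set ℓ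
  Kernel A v = IsZeroVec (apply A v)

  TrivialKernel : ∀ {m n} → Mat m n → Set (c ⊔ ℓ)
  TrivialKernel A = ∀ v → Kernel A v → IsZeroVec v

  e₀ : ∀ {n} → Vec (suc n)
  e₀ Fin.zero    = 1#
  e₀ (Fin.suc _) = 0#

  e₀≉0 : ∀ {n} → ¬ IsZeroVec (e₀ {n})
  e₀≉0 e₀≈0 = 0≉1 (sym (e₀≈0 Fin.zero))

  apply-e₀ : ∀ {m n} (A : Mat m (suc n)) i → apply A e₀ i ≈ A i Fin.zero
  apply-e₀ A i = trans (+-cong (*-identityʳ _) (Σ-zero λ j → zeroʳ (A i (Fin.suc j)))) (+-identityʳ _)

  -- Solving the pivot row p for the first coordinate and substituting into the other rows gives
  -- a matrix B with one row and one column fewer whose kernel vectors lift to kernel vectors of A.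
  module PivotElimination {m n} (A : Mat (suc m) (suc n)) (p : Fin (suc m))
                          (Ap₀≉0 : ¬ (A p Fin.zero ≈ 0#)) where
    t : Carrier
    t = proj₁ (inverse (A p Fin.zero) Ap₀≉0)

    factor : Fin (suc m) → Carrier
    factor i = - (A i Fin.zero * t)

    tail : Fin (suc m) → Vec n → Carrier
    tail i w = Σ[ (λ k → A i (Fin.suc k) * w k) ]

    B : Mat m n
    B j k = A (punchIn p j) (Fin.suc k) + factor (punchIn p j) * A p (Fin.suc k)

    lift : Vec n → Vec (suc n)
    lift w Fin.zero    = - (t * tail p w)
    lift w (Fin.suc k) = w k

    apply-lift : ∀ w i → apply A (lift w) i ≈ tail i w + factor i * tail p w
    apply-lift w i = begin
      A i Fin.zero * - (t * tail p w) + tail i w    ≈⟨ +-cong (-‿distribʳ-* _ _) refl ⟨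
      - (A i Fin.zero * (t * tail p w)) + tail i w  ≈⟨ +-cong (-‿cong (*-assoc _ _ _)) refl ⟨
      - (A i Fin.zero * t * tail p w) + tail i w    ≈⟨ +-cong (-‿distribˡ-* _ _) refl ⟩
      factor i * tail p w + tail i w                ≈⟨ +-comm _ _ ⟩
      tail i w + factor i * tail p w                ∎

    factor-pivot : factor p ≈ - 1#
    factor-pivot = -‿cong (proj₂ (inverse (A p Fin.zero) Ap₀≉0))

    apply-lift-pivot : ∀ w → apply A (lift w) p ≈ 0#
    apply-lift-pivot w = begin
      apply A (lift w) p              ≈⟨ apply-lift w p ⟩
      tail p w + factor p * tail p w  ≈⟨ +-cong refl (trans (*-cong factor-pivot refl) (-1*x≈-x _)) ⟩
      tail p w - tail p w             ≈⟨ -‿inverseʳ _ ⟩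
      0#                              ∎

    apply-B : ∀ w j → apply B w j ≈ apply A (lift w) (punchIn p j)
    apply-B w j = begin
      Σ[ (λ k → (A r (Fin.suc k) + factor r * A p (Fin.suc k)) * w k) ]
        ≈⟨ Σ-cong (λ k → trans (distribʳ (w k) _ _) (+-cong refl (*-assoc _ _ _))) ⟩
      Σ[ (λ k → rᵏ k + factor r * pᵏ k) ]       ≈⟨ Σ-+ rᵏ (λ k → factor r * pᵏ k) ⟩
      tail r w + Σ[ (λ k → factor r * pᵏ k) ]  ≈⟨ +-cong refl (*-distribˡ-Σ (factor r) pᵏ) ⟩
      tail r w + factor r * tail p w           ≈⟨ apply-lift w r ⟨
      apply A (lift w) r                       ∎
      where
      r : Fin (suc m)
      r = punchIn p j
      rᵏ pᵏ : Fin n → Carrier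
      rᵏ k = A r (Fin.suc k) * w k
      pᵏ k = A p (Fin.suc k) * w k

    lift-Kernel : ∀ w → Kernel B w → Kernel A (lift w)
    lift-Kernel w Bw≈0 i with p ≟ᶠ i
    ... | yes ≡.refl = apply-lift-pivot w
    ... | no p≢i   = ≡.subst (λ r → apply A (lift w) r ≈ 0#) (punchIn-punchOut p≢i)
                           (trans (sym (apply-B w (punchOut p≢i))) (Bw≈0 (punchOut p≢i)))

    TrivialKernel-B : TrivialKernel A → TrivialKernel B
    TrivialKernel-B trivial w Bw≈0 k = trivial (lift w) (lift-Kernel w Bw≈0) (Fin.suc k)

  wide⇒¬TrivialKernel : ∀ {m n} → m < n → (A : Mat m n) → ¬ TrivialKernel A
  wide⇒¬TrivialKernel {zero}  {suc n} _ A trivial = e₀≉0 (trivial e₀ λ ())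
  wide⇒¬TrivialKernel {suc m} {suc n} (s≤s m<n) A trivial =
    ¬¬-excluded-middle {A = ∃ λ p → ¬ (A p Fin.zero ≈ 0#)} λ where
    (yes (p , Ap₀≉0)) → let open PivotElimination A p Ap₀≉0 in
      wide⇒¬TrivialKernel m<n B (TrivialKernel-B trivial)
    (no noPivot) → ¬¬-Π-Fin (λ i → ¬∃⟶∀¬ noPivot i) λ column₀≈0 →
      e₀≉0 (trivial e₀ λ i → trans (apply-e₀ A i) (column₀≈0 i))

  leftInverse⇒TrivialKernel : ∀ {m n} (M : Mat m n) (N : Mat n m) →
    (∀ w i → apply M (apply N w) i ≈ w i) → TrivialKernel N
  leftInverse⇒TrivialKernel M N MN≈id w Nw≈0 i = trans (sym (MN≈id w i)) (apply-zero M Nw≈0 i)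

  leftInverse⇒≤ : ∀ {m n} (M : Mat m n) (N : Mat n m) →
    (∀ w i → apply M (apply N w) i ≈ w i) → m ≤ n
  leftInverse⇒≤ {m} {n} M N MN≈id with m ≤? n
  ... | yes m≤n = m≤n
  ... | no  m≰n = ⊥-elim (wide⇒¬TrivialKernel (≰⇒> m≰n) N (leftInverse⇒TrivialKernel M N MN≈id))

  Isometric⇒dim≡ : ∀ {φ ψ} → Isometric φ ψ → dim φ ≡ dim ψ
  Isometric⇒dim≡ (M , N , NM≈id , MN≈id , _) = ≤-antisym (leftInverse⇒≤ N M NM≈id) (leftInverse⇒≤ M N MN≈id)

  SimilarToSubform⇒dim≤ : ∀ {ψ φ} → SimilarToSubform ψ φ → dim ψ ≤ dim φ
  SimilarToSubform⇒dim≤ {ψ} {φ} (a , _ , χ , _ , φ≅aψ⊥χ) =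
    ≤-trans (m≤m+n (dim ψ) (dim χ)) (≤-reflexive (≡.sym (Isometric⇒dim≡ {φ} {(a ·ᶠ ψ) ⊥ χ} φ≅aψ⊥χ)))

lemma2p3 : ∀ {c ℓ : Level} (F : Field c ℓ) → let open FieldTheory F in
    FormallyReal → NonPythagorean → (φ : Form) → Supreme φ → UInvariantIs (dim φ)
lemma2p3 F _ _ φ (φ-anisoTorsion , supreme) =
  (λ ψ ψ-anisoTorsion → SimilarToSubform⇒dim≤ (supreme ψ ψ-anisoTorsion)) ,
  (λ m bound → bound φ φ-anisoTorsion)
  where
  open FieldTheory F
  open LinearAlgebra F
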